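{- There exist a constant $c > 0$ and, for each $n \ge 2$, a regular language $L_n$ that is not suffix-convex and is accepted by a DFA with $O(n)$ states, such that every witness $(u,v,w)$ to the failure of suffix-convexity of $L_n$ satisfies $|w| \ge c n^3$; i.e. the size of the minimal witness is $\Omega(n^3)$.
   Context: A word $u$ is a suffix of $v$ if $v = xu$ for some word $x$. A witness to the failure of suffix-convexity of $L$ is a triple $(u,v,w)$ with $u,w \in L$, $v \notin L$, $u$ a suffix of $v$ and $v$ a suffix of $w$; its size is $|w|$. $L$ is suffix-convex iff no witness exists. -}

module Defs where

open import Data.Nat using (ℕ; _^_)
open import Data.Fin using (Fin)
open import Data.Bool using (Bool; true)
open import Data.List using (List; []; _∷_; _++_; length)
open import Data.Product using (Σ; ∃; _×_; _,_)
open import Data.Integer using (+_)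
open import Data.Rational using (ℚ; _/_)
open import Relation.Binary.PropositionalEquality using (_≡_)
open import Relation.Nullary using (¬_)

Word : ℕ → Set
Word k = List (Fin k)

Language : ℕ → Set₁
Language k = Word k → Set

record DFA (k m : ℕ) : Set where
  field
    initial : Fin m
    δ       : Fin m → Fin k → Fin m
    final   : Fin m → Bool

open DFA public

δ* : ∀ {k m} → DFA k m → Fin m → Word k → Fin m
δ* D q []       = q
δ* D q (a ∷ x)  = δ* D (δ D q a) x

Lang : ∀ {k m} → DFA k m → Language k
Lang D x = final D (δ* D (initial D) x) ≡ true

IsSuffix : ∀ {k} → Word k → Word k → Set
IsSuffix u v = ∃ λ x → v ≡ x ++ u

Witness : ∀ {k} → Language k → Word k → Word k → Word k → Set
Witness L u v w = L u × L w × ¬ L v × IsSuffix u v × IsSuffix v w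

SuffixConvex : ∀ {k} → Language k → Set
SuffixConvex L = ∀ u v w → ¬ Witness L u v w

ℕ→ℚ : ℕ → ℚ
ℕ→ℚ n = + n / 1

-- Let L consist of the words aⁱbaʲ whose membership depends on the class of i (0, 1 or ≥ 2) and on
-- j + 1 modulo the pairwise coprime periods 2n + 1, n + 1, n: for i = 0 accept iff 2n + 1 ∣ j + 1,
-- for i = 1 iff n + 1 ∤ j + 1, for i ≥ 2 iff n ∣ j + 1. In a witness (u, v, w) the three words share
-- their single b and the number j after it, while the number i of a's before it strictly increases;
-- the pattern accept/reject/accept then forces the classes 0, 1, ≥ 2, so all three periods divide
-- j + 1 and |w| ≥ j + 1 ≥ n(n + 1)(2n + 1) ≥ n³. Taking j + 1 = n(n + 1)(2n + 1) and i = 0, 1, 2 gives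
-- a witness, and L is recognised by a DFA that counts i up to 2 and then j modulo the chosen period.
module Submission where

open import Defs
open import Data.Bool using (Bool; true; false; _∧_; not; T)
open import Data.Bool.Properties using (not-injective; ¬-not)
open import Data.Fin using (Fin; toℕ; #_; _↑ˡ_; _↑ʳ_; splitAt)
open import Data.Fin.Properties using (toℕ-fromℕ<; toℕ-injective; splitAt-↑ˡ; splitAt-↑ʳ)
open import Data.Integer using (+<+; +≤+) renaming (_≤_ to _≤ℤ_)
import Data.Integer.Properties as ℤ
open import Data.List using ([]; _∷_; _++_; length; foldl; replicate)
open import Data.List.Properties using (++-assoc; length-++; length-++-≤ʳ; length-replicate)
open import Data.Nat
  using (ℕ; zero; suc; _+_; _*_; _^_; _≤_; _<_; _%_; _≡ᵇ_; z≤n; s≤s; z<s; pred; NonZero)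
open import Data.Nat.Coprimality using (Coprime; coprime-+; coprime-divisor) renaming (sym to coprime-sym)
open import Data.Nat.DivMod using (_mod_; %-distribˡ-+; m%n%n≡m%n)
open import Data.Nat.Divisibility using (_∣_; divides; m%n≡0⇒n∣m; n∣m⇒m%n≡0; ∣1⇒≡1; ∣m+n∣m⇒∣n; *-monoˡ-∣; ∣⇒≤; n∣m*n; m∣m*n; ∣-trans)
open import Data.Nat.Properties
open import Data.Nat.Tactic.RingSolver using (solve-∀)
open import Data.Product using (Σ; _×_; _,_)
open import Data.Rational using (ℚ; 0ℚ; 1ℚ; *≤*; *<*)
  renaming (_<_ to _<ℚ_; _≤_ to _≤ℚ_; _*_ to _*ℚ_)
import Data.Rational.Properties as ℚ
open import Data.Sum using ([_,_])
open import Function using (_∘_)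
open import Relation.Binary.PropositionalEquality hiding ([_])
open import Relation.Nullary using (¬_; contradiction)

run : ∀ {k} {S : Set} → (S → Fin k → S) → S → Word k → S
run = foldl

module EncodedDFA {k m} {S : Set} (step : S → Fin k → S) (accepting : S → Bool) (start : S)
               (encode : S → Fin m) (decode : Fin m → S)
               (decode∘encode : ∀ s → decode (encode s) ≡ s) where

  dfa : DFA k m
  dfa = record { initial = encode start ; δ = λ i c → encode (step (decode i) c) ; final = accepting ∘ decode }

  δ*-encode : ∀ s x → δ* dfa (encode s) x ≡ encode (run step s x)
  δ*-encode s []      = refl
  δ*-encode s (c ∷ x) rewrite decode∘encode s = δ*-encode (step s c) x

  final-δ* : ∀ x → final dfa (δ* dfa (initial dfa) x) ≡ accepting (run step start x)
  final-δ* x rewrite δ*-encode start x = cong accepting (decode∘encode (run step start x))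

next : ∀ {d} .{{_ : NonZero d}} → Fin d → Fin d
next {d} i = suc (toℕ i) mod d

next-mod : ∀ {d} .{{_ : NonZero d}} x → next (x mod d) ≡ suc x mod d
next-mod {d} x = toℕ-injective (begin
  toℕ (suc (toℕ (x mod d)) mod d)  ≡⟨ toℕ-fromℕ< _ ⟩
  suc (toℕ (x mod d)) % d          ≡⟨ cong (λ t → suc t % d) (toℕ-fromℕ< _) ⟩
  (1 + x % d) % d                  ≡⟨ %-distribˡ-+ 1 (x % d) d ⟩
  (1 % d + x % d % d) % d          ≡⟨ cong (λ t → (1 % d + t) % d) (m%n%n≡m%n x d) ⟩
  (1 % d + x % d) % d              ≡⟨ %-distribˡ-+ 1 x d ⟨
  suc x % d                        ≡⟨ toℕ-fromℕ< _ ⟨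
  toℕ (suc x mod d)                ∎)
  where open ≡-Reasoning

%≡ᵇ0⇒∣ : ∀ y d .{{_ : NonZero d}} → (y % d ≡ᵇ 0) ≡ true → d ∣ y
%≡ᵇ0⇒∣ y d h = m%n≡0⇒n∣m y d (≡ᵇ⇒≡ (y % d) 0 (subst T (sym h) _))

∣⇒%≡ᵇ0 : ∀ y d .{{_ : NonZero d}} → d ∣ y → (y % d ≡ᵇ 0) ≡ true
∣⇒%≡ᵇ0 y d d∣y rewrite n∣m⇒m%n≡0 y d d∣y = refl

coprime-suc : ∀ n → Coprime n (suc n)
coprime-suc n {d} (d∣n , d∣1+n) = ∣1⇒≡1 (∣m+n∣m⇒∣n (subst (d ∣_) (+-comm 1 n) d∣1+n) d∣n)

coprime-divisorʳ : ∀ {m n o} → Coprime m n → m ∣ o * n → m ∣ o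
coprime-divisorʳ {m} {n} {o} m⊥n m∣o*n = coprime-divisor m⊥n (subst (m ∣_) (*-comm o n) m∣o*n)

coprime-∣⇒*∣ : ∀ {m n o} → Coprime m n → m ∣ o → n ∣ o → m * n ∣ o
coprime-∣⇒*∣ {m} {n} m⊥n m∣o (divides t o≡t*n) =
  subst (m * n ∣_) (sym o≡t*n) (*-monoˡ-∣ n (coprime-divisorʳ {o = t} m⊥n (subst (m ∣_) o≡t*n m∣o)))

pairwise-coprime-∣⇒*∣ : ∀ {p q r s} → Coprime p q → Coprime p r → Coprime q r →
                        p ∣ s → q ∣ s → r ∣ s → p * q * r ∣ s
pairwise-coprime-∣⇒*∣ {p} {q} {r} {s} p⊥q p⊥r q⊥r p∣s q∣s (divides t s≡t*r) =
  subst (p * q * r ∣_) (sym s≡t*r) (*-monoˡ-∣ r (coprime-∣⇒*∣ p⊥q (divisor p⊥r p∣s) (divisor q⊥r q∣s)))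
  where
  divisor : ∀ {d} → Coprime d r → d ∣ s → d ∣ t
  divisor {d} d⊥r d∣s = coprime-divisorʳ {o = t} d⊥r (subst (d ∣_) s≡t*r d∣s)

pattern a = Fin.zero
pattern b = Fin.suc Fin.zero

#b : Word 2 → ℕ
#b []      = 0
#b (a ∷ w) = #b w
#b (b ∷ w) = suc (#b w)

before-b : Word 2 → ℕ
before-b []      = 0
before-b (a ∷ w) = suc (before-b w)
before-b (b ∷ w) = 0

after-b : Word 2 → ℕ
after-b []      = 0
after-b (a ∷ w) = after-b w
after-b (b ∷ w) = length w

#b-++ : ∀ z u → #b (z ++ u) ≡ #b z + #b u
#b-++ []      u = refl
#b-++ (a ∷ z) u = #b-++ z u
#b-++ (b ∷ z) u = cong suc (#b-++ z u)

#b-replicate-a : ∀ i → #b (replicate i a) ≡ 0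
#b-replicate-a zero    = refl
#b-replicate-a (suc i) = #b-replicate-a i

before-b-++ : ∀ z u → #b z ≡ 0 → before-b (z ++ u) ≡ length z + before-b u
before-b-++ []      u _  = refl
before-b-++ (a ∷ z) u #z = cong suc (before-b-++ z u #z)
before-b-++ (b ∷ z) u ()

after-b-++ : ∀ z u → #b z ≡ 0 → after-b (z ++ u) ≡ after-b u
after-b-++ []      u _  = refl
after-b-++ (a ∷ z) u #z = after-b-++ z u #z
after-b-++ (b ∷ z) u ()

after-b<length : ∀ w → 0 < #b w → after-b w < length w
after-b<length (a ∷ w) 0<#w = m<n⇒m<1+n (after-b<length w 0<#w)
after-b<length (b ∷ w) _    = ≤-refl

data Class : Set where
  none one many : Class

classOf : ℕ → Class
classOf zero          = none
classOf (suc zero)    = one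
classOf (suc (suc _)) = many

grow : Class → Class
grow none = one
grow one  = many
grow many = many

grow-classOf : ∀ i → grow (classOf i) ≡ classOf (suc i)
grow-classOf zero          = refl
grow-classOf (suc zero)    = refl
grow-classOf (suc (suc _)) = refl

module Construction (k : ℕ) where

  n : ℕ
  n = suc k

  -- The periods are n, n + 1 and 2n + 1, written as successors so that instance search finds
  -- NonZero (period c) for every c.
  period : Class → ℕ
  period c = suc (period∸1 c)
    where
    period∸1 : Class → ℕ
    period∸1 none = n + n
    period∸1 one  = n
    period∸1 many = k

  acceptsResidue : Class → ℕ → Bool
  acceptsResidue none z = z ≡ᵇ 0
  acceptsResidue one  z = not (z ≡ᵇ 0)
  acceptsResidue many z = z ≡ᵇ 0

  accepts : Class → ℕ → Bool
  accepts c y = acceptsResidue c (y % period c)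

  member : Word 2 → Bool
  member w = (#b w ≡ᵇ 1) ∧ accepts (classOf (before-b w)) (suc (after-b w))

  data State : Set where
    leading  : Class → State
    counting : (c : Class) → Fin (period c) → State
    dead     : State

  step : State → Fin 2 → State
  step (leading c)    a = leading (grow c)
  -- The counter holds j + 1 modulo the period, j being the number of a's read after the b.
  step (leading c)    b = counting c (1 mod period c)
  step (counting c i) a = counting c (next i)
  step (counting c i) b = dead
  step dead           _ = dead

  accepting : State → Bool
  accepting (counting c i) = acceptsResidue c (toℕ i)
  accepting _              = false

  run-dead : ∀ w → run step dead w ≡ dead
  run-dead []      = refl
  run-dead (_ ∷ w) = run-dead w

  accepting-counting : ∀ c x w → accepting (run step (counting c (x mod period c)) w)
                                 ≡ (#b w ≡ᵇ 0) ∧ accepts c (x + length w)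
  accepting-counting c x [] rewrite +-identityʳ x = cong (acceptsResidue c) (toℕ-fromℕ< _)
  accepting-counting c x (a ∷ w) rewrite next-mod {period c} x | +-suc x (length w) =
    accepting-counting c (suc x) w
  accepting-counting c x (b ∷ w) rewrite run-dead w = refl

  accepting-leading : ∀ i w → accepting (run step (leading (classOf i)) w)
                              ≡ (#b w ≡ᵇ 1) ∧ accepts (classOf (i + before-b w)) (suc (after-b w))
  accepting-leading i [] = refl
  accepting-leading i (a ∷ w) rewrite grow-classOf i | +-suc i (before-b w) = accepting-leading (suc i) w
  accepting-leading i (b ∷ w) rewrite +-identityʳ i = accepting-counting (classOf i) 1 w

  size : ℕ
  size = 4 + (period none + (period one + period many))

  encode : State → Fin size
  encode (leading none)    = # 0
  encode (leading one)     = # 1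
  encode (leading many)    = # 2
  encode dead              = # 3
  encode (counting none i) = 4 ↑ʳ (i ↑ˡ _)
  encode (counting one i)  = 4 ↑ʳ (period none ↑ʳ (i ↑ˡ _))
  encode (counting many i) = 4 ↑ʳ (period none ↑ʳ (period one ↑ʳ i))

  decode : Fin size → State
  decode Fin.zero                                     = leading none
  decode (Fin.suc Fin.zero)                           = leading one
  decode (Fin.suc (Fin.suc Fin.zero))                 = leading many
  decode (Fin.suc (Fin.suc (Fin.suc Fin.zero)))       = dead
  decode (Fin.suc (Fin.suc (Fin.suc (Fin.suc j)))) =
    [ counting none , [ counting one , counting many ] ∘ splitAt (period one) ] (splitAt (period none) j)

  decode∘encode : ∀ s → decode (encode s) ≡ s
  decode∘encode (leading none) = refl
  decode∘encode (leading one)  = refl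
  decode∘encode (leading many) = refl
  decode∘encode dead           = refl
  decode∘encode (counting none i)
    rewrite splitAt-↑ˡ (period none) i (period one + period many) = refl
  decode∘encode (counting one i)
    rewrite splitAt-↑ʳ (period none) (period one + period many) (i ↑ˡ period many)
          | splitAt-↑ˡ (period one) i (period many) = refl
  decode∘encode (counting many i)
    rewrite splitAt-↑ʳ (period none) (period one + period many) (period one ↑ʳ i)
          | splitAt-↑ʳ (period one) (period many) i = refl

  open EncodedDFA step accepting (leading none) encode decode decode∘encode public

  final≡member : ∀ x → final dfa (δ* dfa (initial dfa) x) ≡ member x
  final≡member x = trans (final-δ* x) (accepting-leading 0 x)

  member⇒#b≡1 : ∀ w → member w ≡ true → #b w ≡ 1
  member⇒#b≡1 w h with #b w ≡ᵇ 1 in eq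
  member⇒#b≡1 w h  | true = ≡ᵇ⇒≡ (#b w) 1 (subst T (sym eq) _)

  member-++ : ∀ z u → #b u ≡ 1 → #b z ≡ 0 →
              member (z ++ u) ≡ accepts (classOf (length z + before-b u)) (suc (after-b u))
  member-++ z u #u #z rewrite #b-++ z u | #z | #u | before-b-++ z u #z | after-b-++ z u #z = refl

  accepts-alternation : ∀ y i j l → i < j → j < l →
    accepts (classOf i) y ≡ true → accepts (classOf j) y ≡ false → accepts (classOf l) y ≡ true →
    period none ∣ y × period one ∣ y × period many ∣ y
  accepts-alternation y zero (suc zero) (suc (suc _)) _ _ yes₀ no₁ yes₂ =
    %≡ᵇ0⇒∣ y _ yes₀ , %≡ᵇ0⇒∣ y _ (not-injective no₁) , %≡ᵇ0⇒∣ y _ yes₂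
  accepts-alternation y _ (suc (suc _)) (suc (suc _)) _ _ _ no yes = contradiction (trans (sym no) yes) λ ()
  accepts-alternation y (suc _) (suc zero) _ (s≤s ()) _ _ _ _
  accepts-alternation y _ (suc _) (suc zero) _ (s≤s ()) _ _ _
  accepts-alternation y _ _ zero _ () _ _ _
  accepts-alternation y _ zero _ () _ _ _ _

  many⊥one : Coprime (period many) (period one)
  many⊥one = coprime-suc n

  many⊥none : Coprime (period many) (period none)
  many⊥none = coprime-sym (subst (λ t → Coprime t n) (+-comm n (suc n)) (coprime-+ (coprime-sym (coprime-suc n))))

  one⊥none : Coprime (period one) (period none)
  one⊥none = coprime-sym (coprime-+ (coprime-suc n))

  period-product : ℕ
  period-product = period many * period one * period none

  period-product-∣ : ∀ z₁ z₂ u → 0 < length z₁ → 0 < length z₂ →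
    member u ≡ true → member (z₁ ++ u) ≡ false → member ((z₂ ++ z₁) ++ u) ≡ true →
    period-product ∣ suc (after-b u)
  period-product-∣ z₁ z₂ u 0<∣z₁∣ 0<∣z₂∣ u∈ v∉ w∈ =
    let r∣ , q∣ , p∣ = accepts-alternation (suc (after-b u)) _ _ _ i<j j<l
                         (trans (sym (member-++ [] u #u refl)) u∈)
                         (trans (sym (member-++ z₁ u #u #z₁)) v∉)
                         (trans (sym (member-++ (z₂ ++ z₁) u #u #z₂z₁)) w∈)
    in pairwise-coprime-∣⇒*∣ many⊥one many⊥none one⊥none p∣ q∣ r∣
    where
    #u : #b u ≡ 1
    #u = member⇒#b≡1 u u∈
    #z₂z₁ : #b (z₂ ++ z₁) ≡ 0
    #z₂z₁ = +-cancelʳ-≡ (#b u) _ 0 (trans (sym (#b-++ (z₂ ++ z₁) u)) (trans (member⇒#b≡1 ((z₂ ++ z₁) ++ u) w∈) (sym #u)))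
    #z₁ : #b z₁ ≡ 0
    #z₁ = m+n≡0⇒n≡0 (#b z₂) (trans (sym (#b-++ z₂ z₁)) #z₂z₁)
    i<j : before-b u < length z₁ + before-b u
    i<j = m<n+m (before-b u) 0<∣z₁∣
    j<l : length z₁ + before-b u < length (z₂ ++ z₁) + before-b u
    j<l rewrite length-++ z₂ {z₁} = +-monoˡ-< (before-b u) (m<n+m (length z₁) 0<∣z₂∣)

  witness-length : ∀ u v w → Witness (Lang dfa) u v w → period-product ≤ length w
  witness-length u v w (u∈ , w∈ , v∉ , ([] , refl) , _)            = contradiction u∈ v∉
  witness-length u v w (u∈ , w∈ , v∉ , (_ , refl) , ([] , refl))    = contradiction w∈ v∉
  witness-length u _ _ (u∈ , w∈ , v∉ , (z₁@(_ ∷ _) , refl) , (z₂@(_ ∷ _) , refl)) = begin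
    period-product         ≤⟨ ∣⇒≤ (period-product-∣ z₁ z₂ u z<s z<s u∈′ v∉′ w∈′) ⟩
    suc (after-b u)        ≤⟨ after-b<length u (≤-reflexive (sym (member⇒#b≡1 u u∈′))) ⟩
    length u               ≤⟨ length-++-≤ʳ u {z₂ ++ z₁} ⟩
    length ((z₂ ++ z₁) ++ u) ≡⟨ cong length (++-assoc z₂ z₁ u) ⟩
    length (z₂ ++ z₁ ++ u) ∎
    where
    open ≤-Reasoning
    u∈′ = trans (sym (final≡member u)) u∈
    v∉′ = trans (sym (final≡member (z₁ ++ u))) (¬-not v∉)
    w∈′ = trans (cong member (++-assoc z₂ z₁ u)) (trans (sym (final≡member (z₂ ++ z₁ ++ u))) w∈)

  aⁱbaʲ : ℕ → ℕ → Word 2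
  aⁱbaʲ i j = replicate i a ++ b ∷ replicate j a

  member-aⁱbaʲ : ∀ i j → member (aⁱbaʲ i j) ≡ accepts (classOf i) (suc j)
  member-aⁱbaʲ i j =
    trans (member-++ (replicate i a) (b ∷ replicate j a) (cong suc (#b-replicate-a j)) (#b-replicate-a i))
          (cong₂ (λ i′ j′ → accepts (classOf i′) (suc j′))
                 (trans (+-identityʳ _) (length-replicate i)) (length-replicate j))

  period-∣-product : ∀ c → period c ∣ period-product
  period-∣-product none = n∣m*n (period many * period one)
  period-∣-product one  = ∣-trans (n∣m*n n) (m∣m*n (period none))
  period-∣-product many = ∣-trans (m∣m*n (suc n)) (m∣m*n (period none))

  final-aⁱbaʲ : ∀ i → final dfa (δ* dfa (initial dfa) (aⁱbaʲ i (pred period-product)))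
                      ≡ acceptsResidue (classOf i) 0
  final-aⁱbaʲ i = begin
    final dfa (δ* dfa (initial dfa) (aⁱbaʲ i (pred period-product)))
      ≡⟨ final≡member (aⁱbaʲ i (pred period-product)) ⟩
    member (aⁱbaʲ i (pred period-product))
      ≡⟨ member-aⁱbaʲ i _ ⟩
    accepts (classOf i) (suc (pred period-product))
      ≡⟨ cong (accepts (classOf i)) (suc-pred period-product) ⟩
    acceptsResidue (classOf i) (period-product % period (classOf i))
      ≡⟨ cong (acceptsResidue (classOf i)) (n∣m⇒m%n≡0 _ _ (period-∣-product (classOf i))) ⟩
    acceptsResidue (classOf i) 0 ∎
    where open ≡-Reasoning

  not-suffixConvex : ¬ SuffixConvex (Lang dfa)
  not-suffixConvex convex = convex (aⁱbaʲ 0 X) (aⁱbaʲ 1 X) (aⁱbaʲ 2 X)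
    (final-aⁱbaʲ 0 , final-aⁱbaʲ 2 , (λ v∈ → contradiction (trans (sym (final-aⁱbaʲ 1)) v∈) λ ()) ,
     (a ∷ [] , refl) , (a ∷ [] , refl))
    where X = pred period-product

  cube≤period-product : n ^ 3 ≤ period-product
  cube≤period-product = begin
    n * (n * (n * 1))       ≡⟨ cube≡ n ⟩
    n * n * n               ≤⟨ *-mono-≤ (*-monoʳ-≤ n (n≤1+n n)) (m≤n+m n (suc n)) ⟩
    n * suc n * (suc n + n) ∎
    where
    open ≤-Reasoning
    cube≡ : ∀ m → m * (m * (m * 1)) ≡ m * m * m
    cube≡ = solve-∀

  size≤10n : size ≤ 10 * n
  size≤10n = subst (size ≤_) (size+6k≡10n k) (m≤m+n size (6 * k))
    where
    size+6k≡10n : ∀ k → 4 + (suc (suc k + suc k) + (suc (suc k) + suc k)) + 6 * k ≡ 10 * suc k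
    size+6k≡10n = solve-∀

ℕ→ℚ-mono-≤ : ∀ {m n} → m ≤ n → ℕ→ℚ m ≤ℚ ℕ→ℚ n
ℕ→ℚ-mono-≤ {m} {n} m≤n
  rewrite ℚ.normalize-coprime {m} {0} (λ (_ , d∣1) → ∣1⇒≡1 d∣1)
        | ℚ.normalize-coprime {n} {0} (λ (_ , d∣1) → ∣1⇒≡1 d∣1) =
  *≤* (subst₂ _≤ℤ_ (sym (ℤ.*-identityʳ _)) (sym (ℤ.*-identityʳ _)) (+≤+ m≤n))

theorem13 : Σ ℚ λ c → 0ℚ <ℚ c × Σ ℕ λ C → (n : ℕ) → 2 ≤ n →
    Σ ℕ λ k → Σ ℕ λ m → Σ (DFA k m) λ D →
    m ≤ C * n × ¬ SuffixConvex (Lang D) ×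
    (∀ u v w → Witness (Lang D) u v w → c *ℚ ℕ→ℚ (n ^ 3) ≤ℚ ℕ→ℚ (length w))
theorem13 = 1ℚ , *<* (+<+ (s≤s z≤n)) , 10 , λ where
  -- The construction works for every n ≥ 1.
  (suc k) _ → let open Construction k in
    2 , size , dfa , size≤10n , not-suffixConvex , λ u v w witness →
      subst (_≤ℚ ℕ→ℚ (length w)) (sym (ℚ.*-identityˡ _))
            (ℕ→ℚ-mono-≤ (≤-trans cube≤period-product (witness-length u v w witness)))
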